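{- Let $\phi$ be an $\mathcal{FL}^21\mathrm{T}$-formula in clause normal form over a signature $\Sigma\cup\{\mathfrak{t}\}$, and suppose $\phi$ has $s$ existential and $t$ universal conjuncts. Then there exists a clause normal form $\mathcal{FL}^21\mathrm{T}^u$-formula $\phi'$ over a signature $\Sigma'\cup\{\mathfrak{t}\}$ such that: (i) $\phi'$ has at most $2^ts$ existential and $2^t$ universal conjuncts; (ii) $|\Sigma'|\leq|\Sigma|+2^t(s+1)$; (iii) if $\phi$ has a model, so does $\phi'$; (iv) if $\phi'$ has a model of size $M$, then $\phi$ has a model of size at most $sM$.
   Context: No equality; $\Sigma$ is a signature of predicates of positive arity not containing the distinguished binary predicate $\mathfrak{t}$, which is always interpreted as a transitive relation. $\mathcal{FL}^21\mathrm{T}$ is the two-variable fluted fragment over $\Sigma\cup\{\mathfrak{t}\}$ (atoms have argument list $x_h,\ldots,x_m$, quantification always binds the last variable of the current prefix $x_1,\ldots,x_m$), and $\mathcal{FL}^21\mathrm{T}^u$ is its sub-fragment in which $\mathfrak{t}$ is the only binary predicate. A fluted $m$-atom is an atom $p(x_h,\ldots,x_m)$ with $p\in\Sigma\cup\{\mathfrak{t}\}$ of arity $m-h+1$; a fluted $m$-clause is a disjunction of fluted $m$-literals (possibly empty). A formula is in clause normal form if it is $\forall x_1 x_2.\Omega\wedge\bigwedge_{i=1}^s\forall x_1(\alpha_i\to\exists x_2.\Gamma_i)\wedge\bigwedge_{j=1}^t\forall x_1(\beta_j\to\forall x_2.\Delta_j)$ (for $m=2$; in general $\forall x_1\cdots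 x_m.\Omega\wedge\bigwedge_i\forall x_1\cdots x_{m-1}(\alpha_i\to\exists x_m.\Gamma_i)\wedge\bigwedge_j\forall x_1\cdots x_{m-1}(\beta_j\to\forall x_m.\Delta_j)$), where $\Omega,\Gamma_i,\Delta_j$ are sets of fluted $m$-clauses and $\alpha_i,\beta_j$ fluted $(m-1)$-atoms; the conjuncts $\forall\ldots(\alpha_i\to\exists\ldots)$ are the existential conjuncts and the $\forall\ldots(\beta_j\to\forall\ldots)$ the universal conjuncts. -}

module Defs where

open import Data.Nat using (ℕ; _≤_)
open import Data.Fin using (Fin)
open import Data.Bool using (Bool; true; false; not)
open import Data.List using (List; length)
open import Data.List.Relation.Unary.All using (All)
open import Data.List.Relation.Unary.Any using (Any)
open import Data.Vec using (Vec; []; _∷_)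
open import Data.Product using (Σ; _×_; _,_; proj₁; proj₂)
open import Data.Empty using (⊥)
open import Data.Unit using (⊤)
open import Relation.Binary.PropositionalEquality using (_≡_; subst; sym)

-- A signature Σ: finitely many predicate symbols (Fin size), each of
-- positive arity.  The distinguished transitive predicate 𝔱 is NOT a
-- member; it is added separately below.  |Σ| = size.
record Signature : Set where
  field
    size     : ℕ
    arity    : Fin size → ℕ
    positive : ∀ p → 1 ≤ arity p
open Signature public

-- Fluted 2-atoms over Σ ∪ {𝔱} (variables x₁, x₂):
--   p(x₁,x₂) for binary p ∈ Σ,  𝔱(x₁,x₂),  p(x₂) for unary p ∈ Σ.
data Atom2 (S : Signature) : Set where
  bin   : (p : Fin (size S)) → arity S p ≡ 2 → Atom2 S
  tr    : Atom2 S
  un    : (p : Fin (size S)) → arity S p ≡ 1 → Atom2 S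

data Atom1 (S : Signature) : Set where
  un1 : (p : Fin (size S)) → arity S p ≡ 1 → Atom1 S

-- Fluted 2-literal: (true , A) is A, (false , A) is ¬A.
Literal2 : Signature → Set
Literal2 S = Bool × Atom2 S

Clause2 : Signature → Set
Clause2 S = List (Literal2 S)

-- Clause normal form (m = 2):
--   ∀x₁x₂.Ω ∧ ⋀ᵢ ∀x₁(αᵢ → ∃x₂.Γᵢ) ∧ ⋀ⱼ ∀x₁(βⱼ → ∀x₂.Δⱼ)
record CNF (S : Signature) : Set where
  field
    Ω            : List (Clause2 S)
    existentials : List (Atom1 S × List (Clause2 S))
    universals   : List (Atom1 S × List (Clause2 S))
open CNF public

#ex : ∀ {S} → CNF S → ℕ
#ex φ = length (existentials φ)

#univ : ∀ {S} → CNF S → ℕ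
#univ φ = length (universals φ)

-- φ is in FL²1Tᵘ: 𝔱 is the only binary predicate occurring.
NotBin : ∀ {S} → Atom2 S → Set
NotBin (bin _ _) = ⊥
NotBin tr        = ⊤
NotBin (un _ _)  = ⊤

UniformClauses : ∀ {S} → List (Clause2 S) → Set
UniformClauses cs = All (All (λ l → NotBin (proj₂ l))) cs

Uniform : ∀ {S} → CNF S → Set
Uniform φ = UniformClauses (Ω φ)
          × All (λ c → UniformClauses (proj₂ c)) (existentials φ)
          × All (λ c → UniformClauses (proj₂ c)) (universals φ)

record Structure (S : Signature) (A : Set) : Set where
  field
    rel     : (p : Fin (size S)) → Vec A (arity S p) → Bool
    𝔱       : A → A → Bool
    𝔱-trans : ∀ a b c → 𝔱 a b ≡ true → 𝔱 b c ≡ true → 𝔱 a c ≡ true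
open Structure public

module _ {S : Signature} {A : Set} (𝔄 : Structure S A) where

  evalAtom2 : Atom2 S → A → A → Bool
  evalAtom2 (bin p e) a b = rel 𝔄 p (subst (Vec A) (sym e) (a ∷ b ∷ []))
  evalAtom2 tr        a b = 𝔱 𝔄 a b
  evalAtom2 (un p e)  a b = rel 𝔄 p (subst (Vec A) (sym e) (b ∷ []))

  evalAtom1 : Atom1 S → A → Bool
  evalAtom1 (un1 p e) a = rel 𝔄 p (subst (Vec A) (sym e) (a ∷ []))

  evalLit : Literal2 S → A → A → Bool
  evalLit (true  , α) a b = evalAtom2 α a b
  evalLit (false , α) a b = not (evalAtom2 α a b)

  ClauseHolds : A → A → Clause2 S → Set
  ClauseHolds a b c = Any (λ l → evalLit l a b ≡ true) c

  ClausesHold : A → A → List (Clause2 S) → Set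
  ClausesHold a b cs = All (ClauseHolds a b) cs

  Satisfies : CNF S → Set
  Satisfies φ =
      (∀ a b → ClausesHold a b (Ω φ))
    × All (λ c → ∀ a → evalAtom1 (proj₁ c) a ≡ true →
                   Σ A (λ b → ClausesHold a b (proj₂ c)))
          (existentials φ)
    × All (λ c → ∀ a → evalAtom1 (proj₁ c) a ≡ true →
                   ∀ b → ClausesHold a b (proj₂ c))
          (universals φ)

record Model {S : Signature} (φ : CNF S) (A : Set) : Set where
  field
    structure  : Structure S A
    inhabitant : A
    satisfies  : Satisfies structure φ

HasModel : ∀ {S} → CNF S → Set₁
HasModel φ = Σ Set (λ A → Model φ A)

ModelOfSize : ∀ {S} → CNF S → ℕ → Set
ModelOfSize φ M = Model φ (Fin M)

-- Every clause of φ speaks only about the atomic type of a pair (x₁, x₂), i.e. the truth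
-- values of the fluted 2-atoms there. Eliminating each binary predicate of Σ by Davis–Putnam
-- resolution turns a clause set into a set without binary atoms which an atomic type
-- satisfies exactly when its binary atoms can be chosen so that it satisfies the original set.
-- For each set m of universal conjuncts, φ' has a fresh unary R₀ₘ, forced wherever all βⱼ
-- (j ∈ m) hold and guarding the projection of Ω together with the Δⱼ (j ∈ m); for each
-- existential conjunct i it has Rᵢ₊₁ₘ, forced where moreover αᵢ holds and guarding the same
-- projection together with Γᵢ. A model of φ becomes one of φ' by reading the fresh predicates
-- off the guards. Conversely, in a model of φ' every pair can be given binary atoms completing
-- the projected constraints it carries; as a pair can only complete one Γᵢ, every element is
-- duplicated once per existential conjunct, giving a model of size (s ⊔ 1)·M.

module Submission where

open import Data.Bool using (Bool; true; false; not; if_then_else_)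
import Data.Bool as Bool
open import Data.Bool.Properties using (not-injective; ¬-not)
open import Data.Empty using (⊥-elim)
open import Data.Fin
  using (Fin; zero; suc; _≟_; toℕ; fromℕ<; inject≤; splitAt; _↑ˡ_; _↑ʳ_; combine; remQuot; finToFun; funToFin)
open import Data.Fin.Properties
  using ( toℕ-injective; toℕ-fromℕ<; toℕ-inject≤; toℕ<n; splitAt-↑ˡ; splitAt-↑ʳ; remQuot-combine
        ; 2↔Bool; finToFun-funToFin)
open import Data.List
  using (List; []; _∷_; _++_; map; foldr; filter; cartesianProductWith; concatMap; allFin; tabulate; lookup)
open import Data.List.Properties using (length-tabulate)
open import Data.List.Relation.Unary.All as All using (All; []; _∷_)
open import Data.List.Relation.Unary.All.Properties as All using (¬All⇒Any¬)
open import Data.List.Relation.Unary.Any as Any using (Any; here; there; any?)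
open import Data.List.Relation.Unary.Any.Properties as Any using ()
open import Data.List.Membership.Propositional using (_∈_; lose; find)
open import Data.List.Membership.Propositional.Properties
  using (∈-lookup; ∈-++⁺ˡ; ∈-++⁺ʳ; ∈-map⁺; ∈-filter⁺; ∈-filter⁻; ∈-cartesianProductWith⁺; ∈-allFin)
open import Data.Maybe using (Maybe; just; nothing)
import Data.Maybe.Properties as Maybe
open import Data.Nat using (ℕ; _≤_; _+_; _*_; _^_; _⊔_; s≤s; z≤n)
import Data.Nat as ℕ
open import Data.Nat.Properties
  using (≡-irrelevant; ≤-refl; ≤-reflexive; m≤m⊔n; m≤n⊔m; _<?_; *-comm; +-comm)
open import Data.Product using (Σ-syntax; ∃; _×_; _,_; proj₁; proj₂; map₂; uncurry)
open import Data.Sum using (_⊎_; inj₁; inj₂; [_,_]′)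
import Data.Sum as Sum
open import Data.Unit using (⊤; tt)
open import Data.Vec using (Vec; []; _∷_)
open import Function using (_∘_; id)
open import Function.Bundles using (Inverse)
open import Relation.Binary.PropositionalEquality
open import Relation.Nullary using (¬_; Dec; yes; no; does; contradiction)
open import Relation.Nullary.Decidable using (_×-dec_; ¬?; dec-true)

open import Defs

Valuation : Signature → Set
Valuation S = Atom2 S → Bool

module _ {S : Signature} where

  infix 4 _⊨ˡ_ _⊨_ _⊨*_

  _⊨ˡ_ : Valuation S → Literal2 S → Set
  V ⊨ˡ (b , α) = V α ≡ b

  _⊨_ : Valuation S → Clause2 S → Set
  V ⊨ c = Any (V ⊨ˡ_) c

  _⊨*_ : Valuation S → List (Clause2 S) → Set
  V ⊨* cs = All (V ⊨_) cs

  _⊨?_ : ∀ V c → Dec (V ⊨ c)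
  V ⊨? c = any? (λ l → V (proj₂ l) Bool.≟ proj₁ l) c

  ⊨*-resp-≗ : ∀ {V W cs} → (∀ α → V α ≡ W α) → V ⊨* cs → W ⊨* cs
  ⊨*-resp-≗ V≗W = All.map (Any.map λ {l} v → trans (sym (V≗W (proj₂ l))) v)

module _ {S S′ : Signature} where

  rename : (Atom2 S → Atom2 S′) → List (Clause2 S) → List (Clause2 S′)
  rename f = map (map (map₂ f))

  rename⁺ : ∀ {f V cs} → V ∘ f ⊨* cs → V ⊨* rename f cs
  rename⁺ = All.map⁺ ∘ All.map Any.map⁺

  rename⁻ : ∀ {f V} cs → V ⊨* rename f cs → V ∘ f ⊨* cs
  rename⁻ cs = All.map Any.map⁻ ∘ All.map⁻

  rename-uniform : ∀ {f cs} → (∀ α → NotBin α → NotBin (f α)) →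
    UniformClauses cs → UniformClauses (rename f cs)
  rename-uniform f-NotBin = All.map⁺ ∘ All.map (All.map⁺ ∘ All.map λ {l} → f-NotBin (proj₂ l))

-- Davis–Putnam elimination of the binary predicates

module Elimination {S : Signature} where

  occurrence : Fin (size S) → Literal2 S → Maybe Bool
  occurrence p (b , bin q _) = if does (q ≟ p) then just b else nothing
  occurrence p (_ , tr)      = nothing
  occurrence p (_ , un _ _)  = nothing

  Free : Fin (size S) → Literal2 S → Set
  Free p l = occurrence p l ≡ nothing

  Occurs : Bool → Fin (size S) → Clause2 S → Set
  Occurs b p c = Any (λ l → occurrence p l ≡ just b) c

  Occurs? : ∀ b p c → Dec (Occurs b p c)
  Occurs? b p c = any? (λ l → Maybe.≡-dec Bool._≟_ (occurrence p l) (just b)) c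

  Only : Bool → Fin (size S) → Clause2 S → Set
  Only b p c = Occurs b p c × ¬ Occurs (not b) p c

  Clean : Fin (size S) → Clause2 S → Set
  Clean p c = ¬ Occurs true p c × ¬ Occurs false p c

  strip : Fin (size S) → Clause2 S → Clause2 S
  strip p [] = []
  strip p (l ∷ c) with occurrence p l
  ... | nothing = l ∷ strip p c
  ... | just _  = strip p c

  Only? : ∀ b p c → Dec (Only b p c)
  Only? b p c = Occurs? b p c ×-dec ¬? (Occurs? (not b) p c)

  Clean? : ∀ p c → Dec (Clean p c)
  Clean? p c = ¬? (Occurs? true p c) ×-dec ¬? (Occurs? false p c)

  -- Clauses containing both p and ¬p are tautologies and are dropped.
  eliminate : Fin (size S) → List (Clause2 S) → List (Clause2 S)
  eliminate p cs =
    map (strip p) (filter (Clean? p) cs)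
    ++ cartesianProductWith (λ c d → strip p c ++ strip p d)
         (filter (Only? true p) cs) (filter (Only? false p) cs)

  strip-free : ∀ p c → All (Free p) (strip p c)
  strip-free p [] = []
  strip-free p (l ∷ c) with occurrence p l in eq
  ... | nothing = eq ∷ strip-free p c
  ... | just _  = strip-free p c

  strip⁺ : ∀ {Q : Literal2 S → Set} p {c} → All Q c → All Q (strip p c)
  strip⁺ p [] = []
  strip⁺ p {l ∷ c} (q ∷ qs) with occurrence p l
  ... | nothing = q ∷ strip⁺ p qs
  ... | just _  = strip⁺ p qs

  eliminate-All : ∀ {Q : Literal2 S → Set} p {cs} →
    (∀ {c} → c ∈ cs → All Q (strip p c)) → All (All Q) (eliminate p cs)
  eliminate-All p {cs} Q-strip =
    All.++⁺ (All.map⁺ (All.tabulate (Q-strip ∘ proj₁ ∘ ∈-filter⁻ (Clean? p))))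
      (All.cartesianProductWith⁺ (setoid _) (setoid _) _ _ _ λ c∈ d∈ →
        All.++⁺ (Q-strip (proj₁ (∈-filter⁻ (Only? true p) c∈)))
                (Q-strip (proj₁ (∈-filter⁻ (Only? false p) d∈))))

  TrueOccurrence : Valuation S → Bool → Fin (size S) → Clause2 S → Set
  TrueOccurrence V b p c = Any (λ l → occurrence p l ≡ just b × V ⊨ˡ l) c

  literal-sign : ∀ (V : Valuation S) {p l l′ b b′} →
    occurrence p l ≡ just b → occurrence p l′ ≡ just b′ → V ⊨ˡ l → V ⊨ˡ l′ → b ≡ b′
  literal-sign V {p} {_ , bin q e} {_ , bin q′ e′} o o′ v v′ with q ≟ p | q′ ≟ p
  literal-sign V {p} {_ , bin q e} {_ , bin q′ e′} refl refl v v′ | yes refl | yes refl =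
    trans (sym v) (trans (cong (V ∘ bin p) (≡-irrelevant e e′)) v′)

  occurrence-sign : ∀ {V : Valuation S} {p b b′ c d} →
    TrueOccurrence V b p c → TrueOccurrence V b′ p d → b ≡ b′
  occurrence-sign {V} w w′ =
    let o , v = Any.lookup-result w ; o′ , v′ = Any.lookup-result w′ in literal-sign V o o′ v v′

  strip-or-occurs : ∀ {V : Valuation S} p {c} → V ⊨ c → V ⊨ strip p c ⊎ ∃ λ b → TrueOccurrence V b p c
  strip-or-occurs p {l ∷ c} v with occurrence p l in eq | v
  ... | nothing | here v₀  = inj₁ (here v₀)
  ... | just b  | here v₀  = inj₂ (b , here (eq , v₀))
  ... | nothing | there v′ = Sum.map there (map₂ there) (strip-or-occurs p v′)
  ... | just _  | there v′ = Sum.map₂ (map₂ there) (strip-or-occurs p v′)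

  only-sign : ∀ {V : Valuation S} {p c} b b′ → ¬ Occurs (not b) p c →
    TrueOccurrence V b′ p c → b′ ≡ b
  only-sign true  true  _ _ = refl
  only-sign false false _ _ = refl
  only-sign true  false ¬o w = contradiction (Any.map proj₁ w) ¬o
  only-sign false true  ¬o w = contradiction (Any.map proj₁ w) ¬o

  strip-sound : ∀ {V : Valuation S} {p c} → Clean p c → V ⊨ c → V ⊨ strip p c
  strip-sound {p = p} (¬pos , ¬neg) v with strip-or-occurs p v
  ... | inj₁ w = w
  ... | inj₂ (true  , w) = contradiction (Any.map proj₁ w) ¬pos
  ... | inj₂ (false , w) = contradiction (Any.map proj₁ w) ¬neg

  resolvent-sound : ∀ {V : Valuation S} {p c d} → Only true p c → Only false p d →
    V ⊨ c → V ⊨ d → V ⊨ strip p c ++ strip p d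
  resolvent-sound {p = p} {c} (_ , ¬neg) (_ , ¬pos) vc vd
    with strip-or-occurs p vc | strip-or-occurs p vd
  ... | inj₁ w | _      = Any.++⁺ˡ w
  ... | inj₂ _ | inj₁ w = Any.++⁺ʳ (strip p c) w
  ... | inj₂ (b , w) | inj₂ (b′ , w′)
    with refl ← only-sign true b ¬neg w | refl ← only-sign false b′ ¬pos w′
    with () ← occurrence-sign w w′

  eliminate-sound : ∀ {V : Valuation S} p {cs} → V ⊨* cs → V ⊨* eliminate p cs
  eliminate-sound p H =
    All.++⁺ (All.map⁺ (All.tabulate λ c∈ →
               let c∈cs , clean = ∈-filter⁻ (Clean? p) c∈ in strip-sound clean (All.lookup H c∈cs)))
      (All.cartesianProductWith⁺ (setoid _) (setoid _) _ _ _ λ c∈ d∈ →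
        let c∈cs , only-c = ∈-filter⁻ (Only? true p) c∈
            d∈cs , only-d = ∈-filter⁻ (Only? false p) d∈
        in resolvent-sound only-c only-d (All.lookup H c∈cs) (All.lookup H d∈cs))

  _[_≔_] : Valuation S → Fin (size S) → Bool → Valuation S
  (V [ p ≔ x ]) (bin q e) = if does (q ≟ p) then x else V (bin q e)
  (V [ p ≔ x ]) α         = V α

  ≔-NotBin : ∀ V p x α → NotBin α → (V [ p ≔ x ]) α ≡ V α
  ≔-NotBin V p x tr       _ = refl
  ≔-NotBin V p x (un _ _) _ = refl

  ≔-free : ∀ V p x l → Free p l → (V [ p ≔ x ]) (proj₂ l) ≡ V (proj₂ l)
  ≔-free V p x (_ , bin q e) f with q ≟ p
  ≔-free V p x (_ , bin q e) () | yes _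
  ... | no _ = refl
  ≔-free V p x (_ , tr)      _ = refl
  ≔-free V p x (_ , un _ _)  _ = refl

  ≔-occurs : ∀ V p x l → occurrence p l ≡ just x → V [ p ≔ x ] ⊨ˡ l
  ≔-occurs V p x (_ , bin q e) o with q ≟ p
  ≔-occurs V p x (_ , bin q e) refl | yes _ = refl

  strip-⊨-≔ : ∀ {V p} x {c} → V ⊨ strip p c → V [ p ≔ x ] ⊨ c
  strip-⊨-≔ {V} {p} x {l ∷ c} v with occurrence p l in eq | v
  ... | nothing | here v₀  = here (trans (≔-free V p x l eq) v₀)
  ... | nothing | there v′ = there (strip-⊨-≔ x v′)
  ... | just _  | v′       = there (strip-⊨-≔ x v′)

  occurs-⊨-≔ : ∀ {V p x c} → Occurs x p c → V [ p ≔ x ] ⊨ c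
  occurs-⊨-≔ {V} {p} {x} = Any.map λ {l} → ≔-occurs V p x l

  module Completion {V : Valuation S} {p cs} (H : V ⊨* eliminate p cs) where

    clean-strip : ∀ {c} → c ∈ cs → Clean p c → V ⊨ strip p c
    clean-strip c∈ clean = All.lookup H (∈-++⁺ˡ (∈-map⁺ (strip p) (∈-filter⁺ (Clean? p) c∈ clean)))

    resolvent : ∀ {c d} → c ∈ cs → d ∈ cs → Only true p c → Only false p d →
      V ⊨ strip p c ++ strip p d
    resolvent c∈ d∈ only-c only-d = All.lookup H (∈-++⁺ʳ _ (∈-cartesianProductWith⁺ _
      (∈-filter⁺ (Only? true p) c∈ only-c) (∈-filter⁺ (Only? false p) d∈ only-d)))

    Blocked : Clause2 S → Set
    Blocked c = Only true p c × ¬ V ⊨ strip p c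

    set-true : Any Blocked cs → ∀ {c} → c ∈ cs → V [ p ≔ true ] ⊨ c
    set-true blocked {c} c∈ with Occurs? true p c | Occurs? false p c
    ... | yes pos | _       = occurs-⊨-≔ pos
    ... | no ¬pos | no ¬neg = strip-⊨-≔ true (clean-strip c∈ (¬pos , ¬neg))
    ... | no ¬pos | yes neg with V ⊨? strip p c
    ...   | yes v = strip-⊨-≔ true v
    ...   | no ¬v with c₀ , c₀∈ , only-c₀ , ¬v₀ ← find blocked
                    with Any.++⁻ (strip p c₀) (resolvent c₀∈ c∈ only-c₀ (neg , ¬pos))
    ...     | inj₁ v₀ = contradiction v₀ ¬v₀
    ...     | inj₂ v  = contradiction v ¬v

    set-false : ¬ Any Blocked cs → ∀ {c} → c ∈ cs → V [ p ≔ false ] ⊨ c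
    set-false ¬blocked {c} c∈ with Occurs? true p c | Occurs? false p c
    ... | _       | yes neg = occurs-⊨-≔ neg
    ... | no ¬pos | no ¬neg = strip-⊨-≔ false (clean-strip c∈ (¬pos , ¬neg))
    ... | yes pos | no ¬neg with V ⊨? strip p c
    ...   | yes v = strip-⊨-≔ false v
    ...   | no ¬v = contradiction (lose c∈ ((pos , ¬neg) , ¬v)) ¬blocked

  -- p is made true exactly when some clause containing only p positively is not
  -- already satisfied without p.
  eliminate-complete : ∀ {V : Valuation S} p {cs} → V ⊨* eliminate p cs → ∃ λ x → V [ p ≔ x ] ⊨* cs
  eliminate-complete {V} p {cs} H with any? (λ c → Only? true p c ×-dec ¬? (V ⊨? strip p c)) cs
  ... | yes blocked = true  , All.tabulate (set-true blocked)   where open Completion {p = p} {cs} H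
  ... | no ¬blocked = false , All.tabulate (set-false ¬blocked) where open Completion {p = p} {cs} H

  eliminateAll : List (Fin (size S)) → List (Clause2 S) → List (Clause2 S)
  eliminateAll ps cs = foldr eliminate cs ps

  eliminateAll-sound : ∀ {V : Valuation S} ps {cs} → V ⊨* cs → V ⊨* eliminateAll ps cs
  eliminateAll-sound []       H = H
  eliminateAll-sound (p ∷ ps) H = eliminate-sound p (eliminateAll-sound ps H)

  infix 4 _≈ᵘ_

  _≈ᵘ_ : Valuation S → Valuation S → Set
  V ≈ᵘ W = ∀ α → NotBin α → V α ≡ W α

  eliminateAll-complete : ∀ {V : Valuation S} ps {cs} → V ⊨* eliminateAll ps cs →
    Σ[ W ∈ Valuation S ] V ≈ᵘ W × W ⊨* cs
  eliminateAll-complete {V} []       H = V , (λ _ _ → refl) , H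
  eliminateAll-complete {V} (p ∷ ps) H
    with x , H′ ← eliminate-complete p H
    with W , V≈W , W⊨ ← eliminateAll-complete ps H′ =
      W , (λ α nb → trans (sym (≔-NotBin V p x α nb)) (V≈W α nb)) , W⊨

  project : List (Clause2 S) → List (Clause2 S)
  project = eliminateAll (allFin (size S))

  project-sound : ∀ {V : Valuation S} {cs} → V ⊨* cs → V ⊨* project cs
  project-sound = eliminateAll-sound (allFin (size S))

  project-complete : ∀ {V : Valuation S} {cs} → V ⊨* project cs → Σ[ W ∈ Valuation S ] V ≈ᵘ W × W ⊨* cs
  project-complete = eliminateAll-complete (allFin (size S))

  eliminateAll-free : ∀ ps cs → All (All (λ l → All (λ q → Free q l) ps)) (eliminateAll ps cs)
  eliminateAll-free []       cs = All.universal (All.universal λ _ → []) cs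
  eliminateAll-free (p ∷ ps) cs = eliminate-All p λ {c} c∈ →
    All.zipWith (λ (f , fs) → f ∷ fs)
      (strip-free p c , strip⁺ p (All.lookup (eliminateAll-free ps cs) c∈))

  free-NotBin : ∀ l → All (λ q → Free q l) (allFin (size S)) → NotBin (proj₂ l)
  free-NotBin (_ , bin q e) free with q ≟ q | All.lookup free (∈-allFin q)
  ... | yes _  | ()
  ... | no q≢q | _ = q≢q refl
  free-NotBin (_ , tr)     _ = tt
  free-NotBin (_ , un _ _) _ = tt

  project-uniform : ∀ cs → UniformClauses (project cs)
  project-uniform cs = All.map (All.map λ {l} → free-NotBin l) (eliminateAll-free _ cs)

-- Structures and the atomic types of their pairs

module _ {S : Signature} {A : Set} (𝔄 : Structure S A) where

  type : A → A → Valuation S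
  type a b α = evalAtom2 𝔄 α a b

  holds⇒⊨ : ∀ {a b cs} → ClausesHold 𝔄 a b cs → type a b ⊨* cs
  holds⇒⊨ = All.map (Any.map λ { {true , _} v → v ; {false , _} v → not-injective v })

  ⊨⇒holds : ∀ {a b cs} → type a b ⊨* cs → ClausesHold 𝔄 a b cs
  ⊨⇒holds = All.map (Any.map λ { {true , _} v → v ; {false , _} v → cong not v })

lift : ∀ {S} → Atom1 S → Atom2 S
lift (un1 p e) = un p e

type-lift : ∀ {S A} (𝔄 : Structure S A) γ x y → type 𝔄 x y (lift γ) ≡ evalAtom1 𝔄 γ y
type-lift 𝔄 (un1 _ _) x y = refl

does-true : ∀ {P : Set} (P? : Dec P) → does P? ≡ true → P
does-true (yes p) _ = p

module FromTables {S : Signature} {A : Set}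
  (unary  : ∀ p → arity S p ≡ 1 → A → Bool)
  (binary : ∀ p → arity S p ≡ 2 → A → A → Bool)
  (t : A → A → Bool) (t-trans : ∀ x y z → t x y ≡ true → t y z ≡ true → t x z ≡ true) where

  private
    relation : ∀ k → (k ≡ 1 → A → Bool) → (k ≡ 2 → A → A → Bool) → Vec A k → Bool
    relation 1 u _ (x ∷ [])     = u refl x
    relation 2 _ b (x ∷ y ∷ []) = b refl x y
    relation _ _ _ _            = false

    relation-unary : ∀ k u b (e : k ≡ 1) x → relation k u b (subst (Vec A) (sym e) (x ∷ [])) ≡ u e x
    relation-unary _ _ _ refl _ = refl

    relation-binary : ∀ k u b (e : k ≡ 2) x y →
      relation k u b (subst (Vec A) (sym e) (x ∷ y ∷ [])) ≡ b e x y
    relation-binary _ _ _ refl _ _ = refl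

  structure : Structure S A
  structure = record
    { rel     = λ p → relation (arity S p) (unary p) (binary p)
    ; 𝔱       = t
    ; 𝔱-trans = t-trans
    }

  tabled : A → A → Valuation S
  tabled x y (bin p e) = binary p e x y
  tabled x y tr        = t x y
  tabled x y (un p e)  = unary p e y

  type-structure : ∀ x y α → type structure x y α ≡ tabled x y α
  type-structure x y (bin p e) = relation-binary (arity S p) (unary p) (binary p) e x y
  type-structure x y tr        = refl
  type-structure x y (un p e)  = relation-unary (arity S p) (unary p) (binary p) e y

-- Expanding a signature by fresh unary predicates

index-irrelevant : ∀ {I R : Set} (g : I → ℕ) {m} (F : (i : I) → g i ≡ m → R) {i j} →
  i ≡ j → (e : g i ≡ m) (e′ : g j ≡ m) → F i e ≡ F j e′
index-irrelevant g F refl e e′ = cong (F _) (≡-irrelevant e e′)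

module Extension (S : Signature) (k : ℕ) where

  private
    n = size S

    arityOf : Fin n ⊎ Fin k → ℕ
    arityOf = [ arity S , (λ _ → 1) ]′

    arityOf-positive : ∀ x → 1 ≤ arityOf x
    arityOf-positive (inj₁ p) = positive S p
    arityOf-positive (inj₂ _) = s≤s z≤n

  S⁺ : Signature
  S⁺ = record
    { size     = n + k
    ; arity    = arityOf ∘ splitAt n
    ; positive = arityOf-positive ∘ splitAt n
    }

  old : Fin n → Fin (size S⁺)
  old p = p ↑ˡ k

  new : Fin k → Fin (size S⁺)
  new c = n ↑ʳ c

  arity-old : ∀ p → arity S⁺ (old p) ≡ arity S p
  arity-old p = cong arityOf (splitAt-↑ˡ n p k)

  arity-new : ∀ c → arity S⁺ (new c) ≡ 1
  arity-new c = cong arityOf (splitAt-↑ʳ n k c)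

  embed : Atom2 S → Atom2 S⁺
  embed (bin p e) = bin (old p) (trans (arity-old p) e)
  embed tr        = tr
  embed (un p e)  = un (old p) (trans (arity-old p) e)

  embed1 : Atom1 S → Atom1 S⁺
  embed1 (un1 p e) = un1 (old p) (trans (arity-old p) e)

  embed-NotBin : ∀ α → NotBin α → NotBin (embed α)
  embed-NotBin tr       _ = tt
  embed-NotBin (un _ _) _ = tt

  module _ {A : Set} (𝔐 : Structure S A) (fresh : Fin k → A → Bool) where

    private
      unaryOf : ∀ x → arityOf x ≡ 1 → A → Bool
      unaryOf (inj₁ p) e a = evalAtom1 𝔐 (un1 p e) a
      unaryOf (inj₂ c) _ a = fresh c a

      binaryOf : ∀ x → arityOf x ≡ 2 → A → A → Bool
      binaryOf (inj₁ p) e a b = evalAtom2 𝔐 (bin p e) a b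
      binaryOf (inj₂ c) ()

      open FromTables {S⁺} (unaryOf ∘ splitAt n) (binaryOf ∘ splitAt n) (𝔱 𝔐) (𝔱-trans 𝔐)

    expand : Structure S⁺ A
    expand = structure

    expand-old : ∀ x y α → type expand x y (embed α) ≡ type 𝔐 x y α
    expand-old x y (bin p e) = trans (type-structure x y (embed (bin p e)))
      (cong-app (cong-app
        (index-irrelevant arityOf binaryOf (splitAt-↑ˡ n p k) (trans (arity-old p) e) e) x) y)
    expand-old x y tr        = refl
    expand-old x y (un p e)  = trans (type-structure x y (embed (un p e)))
      (cong-app (index-irrelevant arityOf unaryOf (splitAt-↑ˡ n p k) (trans (arity-old p) e) e) y)

    expand-new : ∀ c e a → evalAtom1 expand (un1 (new c) e) a ≡ fresh c a
    expand-new c e a = trans (type-structure a a (un (new c) e))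
      (cong-app (index-irrelevant arityOf unaryOf (splitAt-↑ʳ n k c) e refl) a)

-- The reduction

module _ {t : ℕ} where

  member : Fin (2 ^ t) → Fin t → Bool
  member m j = Inverse.to 2↔Bool (finToFun m j)

  encode : (Fin t → Bool) → Fin (2 ^ t)
  encode f = funToFin (Inverse.from 2↔Bool ∘ f)

  member-encode : ∀ f j → member (encode f) j ≡ f j
  member-encode f j =
    trans (cong (Inverse.to 2↔Bool) (finToFun-funToFin _ j)) (Inverse.strictlyInverseˡ 2↔Bool (f j))

  members : Fin (2 ^ t) → List (Fin t)
  members m = filter (λ j → member m j Bool.≟ true) (allFin t)

  members⁺ : ∀ {m j} → member m j ≡ true → j ∈ members m
  members⁺ {m} {j} = ∈-filter⁺ (λ j → member m j Bool.≟ true) (∈-allFin j)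

  members⁻ : ∀ {m j} → j ∈ members m → member m j ≡ true
  members⁻ {m} = proj₂ ∘ ∈-filter⁻ (λ j → member m j Bool.≟ true) {xs = allFin t}

module _ {m : ℕ} (n : ℕ) where

  inject⊔ : Fin m → Fin (m ⊔ n)
  inject⊔ i = inject≤ i (m≤m⊔n m n)

  narrow : Fin (m ⊔ n) → Maybe (Fin m)
  narrow k with toℕ k <? m
  ... | yes k<m = just (fromℕ< k<m)
  ... | no _    = nothing

  narrow-inject⊔ : ∀ i → narrow (inject⊔ i) ≡ just i
  narrow-inject⊔ i with toℕ (inject⊔ i) <? m
  ... | yes lt = cong just (toℕ-injective (trans (toℕ-fromℕ< lt) (toℕ-inject≤ i (m≤m⊔n m n))))
  ... | no ¬lt = contradiction (subst (ℕ._< m) (sym (toℕ-inject≤ i (m≤m⊔n m n))) (toℕ<n i)) ¬lt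

All-lookup⁺ : ∀ {X : Set} {P : X → Set} xs → (∀ i → P (lookup xs i)) → All P xs
All-lookup⁺ {P = P} xs h = All.tabulate λ x∈ → subst P (sym (Any.lookup-index x∈)) (h (Any.index x∈))

module _ {X : Set} {P : X → Set} {a b} {f : Fin a → Fin b → X} where

  tabulate-pairs⁺ : (∀ i j → P (f i j)) → All P (tabulate (uncurry f ∘ remQuot b))
  tabulate-pairs⁺ h = All.tabulate⁺ λ c → h _ _

  tabulate-pairs⁻ : All P (tabulate (uncurry f ∘ remQuot b)) → ∀ i j → P (f i j)
  tabulate-pairs⁻ h i j = subst (P ∘ uncurry f) (remQuot-combine i j) (All.tabulate⁻ h (combine i j))

module Construction (S : Signature) (φ : CNF S) where

  s = #ex φ
  t = #univ φ
  k = 2 ^ t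

  open Extension S ((1 + s) * k) public
  open Elimination

  α : Fin s → Atom1 S
  α i = proj₁ (lookup (existentials φ) i)

  Γ : Fin s → List (Clause2 S)
  Γ i = proj₂ (lookup (existentials φ) i)

  β : Fin t → Atom1 S
  β j = proj₁ (lookup (universals φ) j)

  Δ : Fin t → List (Clause2 S)
  Δ j = proj₂ (lookup (universals φ) j)

  -- Index zero stands for the universal conjuncts and suc i for existential conjunct i;
  -- m is a set of universal conjuncts, encoded as Fin (2 ^ t).
  R : Fin (1 + s) → Fin k → Fin (size S⁺)
  R i m = new (combine i m)

  demands : Fin (1 + s) → Fin k → List (Clause2 S)
  demands zero    m = Ω φ ++ concatMap Δ (members m)
  demands (suc i) m = Γ i ++ demands zero m

  negated : Atom1 S → Literal2 S⁺
  negated γ = false , embed (lift γ)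

  guard : Fin (1 + s) → List (Literal2 S⁺)
  guard zero    = []
  guard (suc i) = negated (α i) ∷ []

  definition : Fin (1 + s) → Fin k → Clause2 S⁺
  definition i m = (true , un (R i m) (arity-new _)) ∷ guard i ++ map (negated ∘ β) (members m)

  conjunct : Fin (1 + s) → Fin k → Atom1 S⁺ × List (Clause2 S⁺)
  conjunct i m = un1 (R i m) (arity-new _) , rename embed (project (demands i m))

  φ⁺ : CNF S⁺
  φ⁺ = record
    { Ω            = tabulate (uncurry definition ∘ remQuot k)
    ; existentials = tabulate (uncurry (conjunct ∘ suc) ∘ remQuot k)
    ; universals   = tabulate (conjunct zero)
    }

  uniform : Uniform φ⁺
  uniform = tabulate-pairs⁺ definition-uniform
          , tabulate-pairs⁺ {f = conjunct ∘ suc} (λ i m → conjunct-uniform (suc i) m)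
          , All.tabulate⁺ (conjunct-uniform zero)
    where
    negated-NotBin : ∀ γ → NotBin (proj₂ (negated γ))
    negated-NotBin (un1 _ _) = tt

    guard-uniform : ∀ i → All (NotBin ∘ proj₂) (guard i)
    guard-uniform zero    = []
    guard-uniform (suc i) = negated-NotBin (α i) ∷ []

    definition-uniform : ∀ i m → All (NotBin ∘ proj₂) (definition i m)
    definition-uniform i m =
      tt ∷ All.++⁺ (guard-uniform i) (All.map⁺ (All.universal (negated-NotBin ∘ β) (members m)))

    conjunct-uniform : ∀ i m → UniformClauses (proj₂ (conjunct i m))
    conjunct-uniform i m = rename-uniform embed-NotBin (project-uniform (demands i m))

  #ex-bound : #ex φ⁺ ≤ 2 ^ #univ φ * #ex φ
  #ex-bound = ≤-reflexive (trans (length-tabulate _) (*-comm s k))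

  #univ-bound : #univ φ⁺ ≤ 2 ^ #univ φ
  #univ-bound = ≤-reflexive (length-tabulate _)

  size-bound : size S⁺ ≤ size S + 2 ^ #univ φ * (#ex φ + 1)
  size-bound = ≤-reflexive (cong (size S +_) (trans (*-comm (1 + s) k) (cong (k *_) (+-comm 1 s))))

  module _ {X : Set} (holds : Atom1 S → X → Bool) where

    Guard : Fin (1 + s) → X → Set
    Guard zero    _ = ⊤
    Guard (suc i) a = holds (α i) a ≡ true

    Guard? : ∀ i a → Dec (Guard i a)
    Guard? zero    _ = yes tt
    Guard? (suc i) a = holds (α i) a Bool.≟ true

    Enabled : Fin (1 + s) → Fin k → X → Set
    Enabled i m a = Guard i a × All (λ j → holds (β j) a ≡ true) (members m)

    Enabled? : ∀ i m a → Dec (Enabled i m a)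
    Enabled? i m a = Guard? i a ×-dec All.all? (λ j → holds (β j) a Bool.≟ true) (members m)

  module Forward {A : Set} (𝔐 : Model φ A) where

    private
      𝔖 = Model.structure 𝔐
      holds = evalAtom1 𝔖

    fresh : Fin ((1 + s) * k) → A → Bool
    fresh c a = does (uncurry (Enabled? holds) (remQuot k c) a)

    𝔖⁺ : Structure S⁺ A
    𝔖⁺ = expand 𝔖 fresh

    R-holds : ∀ i m e a → evalAtom1 𝔖⁺ (un1 (R i m) e) a ≡ does (Enabled? holds i m a)
    R-holds i m e a = trans (expand-new 𝔖 fresh (combine i m) e a)
      (cong (λ (i , m) → does (Enabled? holds i m a)) (remQuot-combine i m))

    enabled : ∀ i m a → evalAtom1 𝔖⁺ (un1 (R i m) (arity-new _)) a ≡ true → Enabled holds i m a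
    enabled i m a h = does-true (Enabled? holds i m a) (trans (sym (R-holds i m _ a)) h)

    negated-holds : ∀ γ x y → holds γ y ≡ false → type 𝔖⁺ x y ⊨ˡ negated γ
    negated-holds γ x y h = trans (expand-old 𝔖 fresh x y (lift γ)) (trans (type-lift 𝔖 γ x y) h)

    guard-holds : ∀ i x y → ¬ Guard holds i y → type 𝔖⁺ x y ⊨ guard i
    guard-holds zero    x y ¬g = contradiction tt ¬g
    guard-holds (suc i) x y ¬g = here (negated-holds (α i) x y (¬-not ¬g))

    definition-holds : ∀ i m x y → type 𝔖⁺ x y ⊨ definition i m
    definition-holds i m x y
      with Guard? holds i y | All.all? (λ j → holds (β j) y Bool.≟ true) (members m)
    ... | yes g | yes bs = here (trans (R-holds i m _ y) (dec-true (Enabled? holds i m y) (g , bs)))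
    ... | no ¬g | _      = there (Any.++⁺ˡ (guard-holds i x y ¬g))
    ... | yes _ | no ¬bs = there (Any.++⁺ʳ (guard i) (Any.map⁺
      (Any.map (λ {j} → negated-holds (β j) x y ∘ ¬-not)
        (¬All⇒Any¬ (λ j → holds (β j) y Bool.≟ true) _ ¬bs))))

    universal-demands : ∀ m x → All (λ j → holds (β j) x ≡ true) (members m) →
      ∀ y → type 𝔖 x y ⊨* demands zero m
    universal-demands m x βs y = All.++⁺ (holds⇒⊨ 𝔖 (proj₁ (Model.satisfies 𝔐) x y))
      (All.concat⁺ (All.map⁺ (All.map (λ {j} βj →
        holds⇒⊨ 𝔖 (All.lookup (proj₂ (proj₂ (Model.satisfies 𝔐))) (∈-lookup j) x βj y)) βs)))

    transfer : ∀ {x y cs} → type 𝔖 x y ⊨* cs → ClausesHold 𝔖⁺ x y (rename embed (project cs))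
    transfer {x} {y} = ⊨⇒holds 𝔖⁺ ∘ rename⁺ ∘ ⊨*-resp-≗ (sym ∘ expand-old 𝔖 fresh x y) ∘ project-sound

    satisfies⁺ : Satisfies 𝔖⁺ φ⁺
    satisfies⁺ =
        (λ x y → ⊨⇒holds 𝔖⁺ (tabulate-pairs⁺ {f = definition} λ i m → definition-holds i m x y))
      , tabulate-pairs⁺ {f = conjunct ∘ suc} (λ i m x h →
          let αi , βs = enabled (suc i) m x h
              y , Γ-holds = All.lookup (proj₁ (proj₂ (Model.satisfies 𝔐))) (∈-lookup i) x αi
          in y , transfer (All.++⁺ (holds⇒⊨ 𝔖 Γ-holds) (universal-demands m x βs y)))
      , All.tabulate⁺ (λ m x h → transfer ∘ universal-demands m x (proj₂ (enabled zero m x h)))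

    model : Model φ⁺ A
    model = record { structure = 𝔖⁺ ; inhabitant = Model.inhabitant 𝔐 ; satisfies = satisfies⁺ }

  module Backward {M : ℕ} (𝔑 : Model φ⁺ (Fin M)) where

    private
      𝔗 = Model.structure 𝔑
      holds : Atom1 S → Fin M → Bool
      holds γ = evalAtom1 𝔗 (embed1 γ)

    type-negated : ∀ γ a b → type 𝔗 a b (proj₂ (negated γ)) ≡ holds γ b
    type-negated (un1 _ _) a b = refl

    negated-false : ∀ γ a b → holds γ b ≡ true → ¬ type 𝔗 a b ⊨ˡ negated γ
    negated-false γ a b h v = contradiction (trans (sym h) (trans (sym (type-negated γ a b)) v)) λ ()

    guard-false : ∀ i a b → Guard holds i b → ¬ type 𝔗 a b ⊨ guard i
    guard-false (suc i) a b αi (here v) = negated-false (α i) a b αi v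

    members-false : ∀ {m} a b → All (λ j → holds (β j) b ≡ true) (members m) →
      ¬ type 𝔗 a b ⊨ map (negated ∘ β) (members m)
    members-false a b βs w with j , j∈ , v ← find (Any.map⁻ w) =
      negated-false (β j) a b (All.lookup βs j∈) v

    R-forced : ∀ i m a → Enabled holds i m a → evalAtom1 𝔗 (un1 (R i m) (arity-new _)) a ≡ true
    R-forced i m a (g , βs)
      with tabulate-pairs⁻ {f = definition} (holds⇒⊨ 𝔗 (proj₁ (Model.satisfies 𝔑) a a)) i m
    ... | here R-true = R-true
    ... | there w = ⊥-elim ([ guard-false i a a g , members-false a a βs ]′ (Any.++⁻ (guard i) w))

    active : Fin M → Fin k
    active a = encode λ j → holds (β j) a

    active-enabled : ∀ a → All (λ j → holds (β j) a ≡ true) (members (active a))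
    active-enabled a = All.tabulate λ {j} j∈ → trans (sym (member-encode _ j)) (members⁻ j∈)

    active-member : ∀ j a → holds (β j) a ≡ true → j ∈ members (active a)
    active-member j a h = members⁺ (trans (member-encode _ j) h)

    universal : ∀ a b → type 𝔗 a b ∘ embed ⊨* project (demands zero (active a))
    universal a b = rename⁻ _ (holds⇒⊨ 𝔗 (All.tabulate⁻ (proj₂ (proj₂ (Model.satisfies 𝔑))) (active a) a
      (R-forced zero (active a) a (tt , active-enabled a)) b))

    existential : ∀ i a → holds (α i) a ≡ true →
      Σ[ b ∈ Fin M ] type 𝔗 a b ∘ embed ⊨* project (demands (suc i) (active a))
    existential i a h =
      let b , H = tabulate-pairs⁻ {f = conjunct ∘ suc} (proj₁ (proj₂ (Model.satisfies 𝔑))) i (active a) a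
                    (R-forced (suc i) (active a) a (h , active-enabled a))
      in b , rename⁻ _ (holds⇒⊨ 𝔗 H)

    witness : Fin s → Fin M → Maybe (Fin M)
    witness i a with holds (α i) a Bool.≟ true
    ... | yes h = just (proj₁ (existential i a h))
    ... | no _  = nothing

    witness-defined : ∀ {i a} → holds (α i) a ≡ true → ∃ λ b → witness i a ≡ just b
    witness-defined {i} {a} h with holds (α i) a Bool.≟ true
    ... | yes _ = _ , refl
    ... | no ¬h = contradiction h ¬h

    witness-demands : ∀ {i a b} → witness i a ≡ just b →
      type 𝔗 a b ∘ embed ⊨* project (demands (suc i) (active a))
    witness-demands {i} {a} eq with holds (α i) a Bool.≟ true
    witness-demands {i} {a} refl | yes h = proj₂ (existential i a h)

    demandIndex : Fin M → Fin (s ⊔ 1) → Fin M → Fin (1 + s)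
    demandIndex a c b with narrow 1 c
    ... | nothing = zero
    ... | just i with witness i a
    ...   | nothing = zero
    ...   | just w with b ≟ w
    ...     | yes _ = suc i
    ...     | no _  = zero

    demandIndex-holds : ∀ a c b → type 𝔗 a b ∘ embed ⊨* project (demands (demandIndex a c b) (active a))
    demandIndex-holds a c b with narrow 1 c
    ... | nothing = universal a b
    ... | just i with witness i a in eq
    ...   | nothing = universal a b
    ...   | just w with b ≟ w
    ...     | yes refl = witness-demands eq
    ...     | no _     = universal a b

    demandIndex-witness : ∀ {i a b} → witness i a ≡ just b → demandIndex a (inject⊔ 1 i) b ≡ suc i
    demandIndex-witness {i} {a} {b} eq with narrow 1 (inject⊔ 1 i) | narrow-inject⊔ 1 i
    ... | .(just i) | refl rewrite eq with b ≟ b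
    ...   | yes _  = refl
    ...   | no b≢b = contradiction refl b≢b

    -- Each element of 𝔑 is duplicated once per existential conjunct, so that the
    -- witnesses of different existential conjuncts never have to share a pair.
    K : ℕ
    K = (s ⊔ 1) * M

    copy : Fin K → Fin (s ⊔ 1)
    copy x = proj₁ (remQuot {s ⊔ 1} M x)

    point : Fin K → Fin M
    point x = proj₂ (remQuot {s ⊔ 1} M x)

    completion : ∀ x y →
      Σ[ W ∈ Valuation S ] type 𝔗 (point x) (point y) ∘ embed ≈ᵘ W
        × W ⊨* demands (demandIndex (point x) (copy y) (point y)) (active (point x))
    completion x y = project-complete (demandIndex-holds (point x) (copy y) (point y))

    private
      unary : ∀ p → arity S p ≡ 1 → Fin K → Bool
      unary p e x = holds (un1 p e) (point x)

      binary : ∀ p → arity S p ≡ 2 → Fin K → Fin K → Bool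
      binary p e x y = proj₁ (completion x y) (bin p e)

      transitive : Fin K → Fin K → Bool
      transitive x y = 𝔱 𝔗 (point x) (point y)

      transitive-trans : ∀ x y z → transitive x y ≡ true → transitive y z ≡ true → transitive x z ≡ true
      transitive-trans x y z = 𝔱-trans 𝔗 (point x) (point y) (point z)

      open FromTables {S} unary binary transitive transitive-trans

    𝔄 : Structure S (Fin K)
    𝔄 = structure

    type-𝔄 : ∀ x y α → type 𝔄 x y α ≡ proj₁ (completion x y) α
    type-𝔄 x y α = trans (type-structure x y α) (tabled≗completion α)
      where
      tabled≗completion : ∀ α → tabled x y α ≡ proj₁ (completion x y) α
      tabled≗completion (bin p e) = refl
      tabled≗completion tr        = proj₁ (proj₂ (completion x y)) tr tt
      tabled≗completion (un p e)  = proj₁ (proj₂ (completion x y)) (un p e) tt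

    holds-𝔄 : ∀ γ x → evalAtom1 𝔄 γ x ≡ holds γ (point x)
    holds-𝔄 (un1 p e) x = type-structure x x (un p e)

    demands-𝔄 : ∀ x y →
      type 𝔄 x y ⊨* demands (demandIndex (point x) (copy y) (point y)) (active (point x))
    demands-𝔄 x y = ⊨*-resp-≗ (sym ∘ type-𝔄 x y) (proj₂ (proj₂ (completion x y)))

    demands-universal : ∀ {V : Valuation S} i m → V ⊨* demands i m → V ⊨* demands zero m
    demands-universal zero    m = id
    demands-universal (suc i) m = All.++⁻ʳ (Γ i)

    universal-demands-𝔄 : ∀ x y → type 𝔄 x y ⊨* demands zero (active (point x))
    universal-demands-𝔄 x y =
      demands-universal (demandIndex (point x) (copy y) (point y)) _ (demands-𝔄 x y)

    satisfies-𝔄 : Satisfies 𝔄 φ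
    satisfies-𝔄 =
        (λ x y → ⊨⇒holds 𝔄 (All.++⁻ˡ (Ω φ) (universal-demands-𝔄 x y)))
      , All-lookup⁺ (existentials φ) (λ i x h →
          let b , eq = witness-defined (trans (sym (holds-𝔄 (α i) x)) h)
              y = combine (inject⊔ 1 i) b
              copy-point = remQuot-combine (inject⊔ 1 i) b
              index≡ = trans (cong (uncurry (demandIndex (point x))) copy-point) (demandIndex-witness eq)
          in y , ⊨⇒holds 𝔄 (All.++⁻ˡ (Γ i)
                   (subst (λ i′ → type 𝔄 x y ⊨* demands i′ _) index≡ (demands-𝔄 x y))))
      , All-lookup⁺ (universals φ) (λ j x h y →
          ⊨⇒holds 𝔄 (All.lookup (All.map⁻ (All.concat⁻ (All.++⁻ʳ (Ω φ) (universal-demands-𝔄 x y))))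
            (active-member j (point x) (trans (sym (holds-𝔄 (β j) x)) h))))

    model : Model φ (Fin K)
    model = record
      { structure  = 𝔄
      ; inhabitant = combine (fromℕ< (m≤n⊔m s 1)) (Model.inhabitant 𝔑)
      ; satisfies  = satisfies-𝔄
      }

lemma9 : (S : Signature) (φ : CNF S) →
  Σ[ S' ∈ Signature ] Σ[ φ' ∈ CNF S' ]
    ( Uniform φ'
    × #ex φ' ≤ 2 ^ #univ φ * #ex φ
    × #univ φ' ≤ 2 ^ #univ φ
    × size S' ≤ size S + 2 ^ #univ φ * (#ex φ + 1)
    × (HasModel φ → HasModel φ')
    × (∀ M → ModelOfSize φ' M →
         Σ[ K ∈ ℕ ] (K ≤ (#ex φ ⊔ 1) * M × ModelOfSize φ K)) )
lemma9 S φ =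
  S⁺ , φ⁺ , uniform , #ex-bound , #univ-bound , size-bound
  , (λ (A , 𝔐) → A , Forward.model 𝔐)
  , (λ M 𝔑 → Backward.K 𝔑 , ≤-refl , Backward.model 𝔑)
  where open Construction S φ
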